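{- Let $\pi=((T,\beta),\rho)$ be an injective $\mathrm{CHA}$-proof with induction order $\sqsubseteq^*$. For $s\in T$ let $S(s):=\{u\in\mathrm{dom}(\beta)\mid\exists t\in\mathrm{dom}(\beta).\ s\in\gamma(t)\wedge t\sqsubseteq^* u\}$. Then $S(s)$ is linearly ordered by $<_\beta$ for every $s\in T$. Moreover, the function $\sigma:T\to\mathrm{dom}(\beta)^*$ assigning to $s$ the enumeration of $S(s)$ in increasing $<_\beta$-order satisfies: (1) if $\varepsilon\notin\mathrm{im}(\beta)$ then $\sigma(\varepsilon)$ is the empty sequence, and otherwise $\sigma(\varepsilon)$ is the one-element sequence consisting of the unique bud $b$ with $\beta(b)=\varepsilon$; (2) if $t$ is a child of $s$ and $t\notin\mathrm{im}(\beta)$, then $\sigma(t)$ is a prefix of $\sigma(s)$; (3) if $t$ is a child of $s$ and $t\in\mathrm{im}(\beta)$, then there is a prefix $u$ of $\sigma(s)$ such that $\sigma(t)=u\cdot b$, where $b$ is the unique bud with $\beta(b)=t$.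
   Context: Language: first-order arithmetic; $\mathrm{CHA}$ rules: standard intuitionistic sequent calculus for first-order logic with equality, weakening, cut, arithmetic axioms, and $\textsc{Case}_x$ (from $\Gamma[0/x]\Rightarrow\delta[0/x]$ and $\Gamma[Sx/x]\Rightarrow\delta[Sx/x]$ infer $\Gamma\Rightarrow\delta$). Trees are non-empty prefix-closed $T\subseteq\omega^*$ with root $\varepsilon$; $s<t$ means strict prefix, $s\le t$ prefix; children of $t$ are the $t\cdot i\in T$. A pre-proof is $((T,\beta),\rho)$, $T$ finite, $\beta$ a partial map from leaves (buds) to inner nodes (companions) with $\beta(t)<t$ (cycle normal form), $\rho$ assigning rule instances to non-bud nodes whose premises label the children, buds carrying their companion's sequent; $\lambda(t)$ is the sequent at $t$. Infinite branches start at the root and step to a child or from a bud to its companion. A $\mathrm{CHA}$-proof is a pre-proof such that along every infinite branch some variable $x$ is eventually free in every sequent and the branch passes $\textsc{Case}_x$ infinitely often. Injective: $\beta$ injective. Local cycle $\gamma(t):=\{u\mid\beta(t)\le u\le t\}$; $C[\eta]:=\bigcup_{s\in\eta}\gamma(s)$; $\eta\subseteq\mathrm{dom}(\beta)$ is strongly connected if some finite path (node sequence with steps as for branches) starting and ending at the same node visits exactly $C[\eta]$. $s\sqsubseteq t$ iff $\beta(s)\in\gamma(t)$; $\sqsubseteq^*$ is its transitive closure. $s<_\beta t$ iff $\beta(s)<\beta(t)$. An induction order is a preorder $\preceq$ on $\mathrm{dom}(\beta)$ with a map $s\mapsto x_s$, $x_s\in\mathrm{FV}(\lambda(s))$, such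 that: $s\preceq t$ implies $x_t\in\mathrm{FV}(\lambda(u))$ for all $u\in\gamma(s)$; an instance of $\textsc{Case}_{x_s}$ is applied along $\gamma(s)$; every strongly connected $\eta\subseteq\mathrm{dom}(\beta)$ has a $\preceq$-maximum in $\eta$. "Induction order $\sqsubseteq^*$" means some map $x_-$ makes $(\sqsubseteq^*,x_-)$ an induction order. Prefix relations on $\mathrm{dom}(\beta)^*$ are the usual ones; $u\cdot b$ appends $b$ to $u$. -}

module Defs where

open import Data.Nat using (ℕ; zero; suc; _<_; _≤_)
open import Data.Fin using (Fin; fromℕ<)
open import Data.List using (List; []; _∷_; _++_; [_]; map; length; lookup; concatMap)
open import Data.List.Membership.Propositional using (_∈_; _∉_)
open import Data.List.Relation.Unary.All using (All)
open import Data.List.Relation.Unary.Linked using (Linked)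
open import Data.List.Relation.Binary.Permutation.Propositional using (_↭_)
open import Data.Maybe using (Maybe; just; nothing)
open import Data.Product using (Σ; ∃; ∃-syntax; _×_; _,_; proj₁; proj₂)
open import Data.Sum using (_⊎_)
open import Data.Empty using (⊥)
open import Relation.Nullary using (¬_)
open import Relation.Binary.PropositionalEquality using (_≡_)
open import Relation.Binary.Construct.Closure.Transitive using (TransClosure)

-- Language of first-order arithmetic (locally nameless syntax):
-- bound variables are de Bruijn indices (bv), free variables are
-- named by natural numbers (fv).

data Term : Set where
  bv   : ℕ → Term
  fv   : ℕ → Term
  `0   : Term
  `S   : Term → Term
  _`+_ : Term → Term → Term
  _`*_ : Term → Term → Term

data Formula : Set where
  ⊥'   : Formula
  _≐_  : Term → Term → Formula
  _∧'_ : Formula → Formula → Formula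
  _∨'_ : Formula → Formula → Formula
  _⊃_  : Formula → Formula → Formula
  ∀'   : Formula → Formula
  ∃'   : Formula → Formula

¬' : Formula → Formula
¬' A = A ⊃ ⊥'

FVt : Term → List ℕ
FVt (bv _)    = []
FVt (fv x)    = x ∷ []
FVt `0        = []
FVt (`S t)    = FVt t
FVt (t `+ u)  = FVt t ++ FVt u
FVt (t `* u)  = FVt t ++ FVt u

FVf : Formula → List ℕ
FVf ⊥'        = []
FVf (t ≐ u)   = FVt t ++ FVt u
FVf (A ∧' B)  = FVf A ++ FVf B
FVf (A ∨' B)  = FVf A ++ FVf B
FVf (A ⊃ B)   = FVf A ++ FVf B
FVf (∀' A)    = FVf A
FVf (∃' A)    = FVf A

substT : ℕ → Term → Term → Term
substT x u (bv i)   = bv i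
substT x u (fv y) with x Data.Nat.≟ y
... | Relation.Nullary.yes _ = u
... | Relation.Nullary.no  _ = fv y
substT x u `0       = `0
substT x u (`S t)   = `S (substT x u t)
substT x u (t `+ s) = substT x u t `+ substT x u s
substT x u (t `* s) = substT x u t `* substT x u s

substF : ℕ → Term → Formula → Formula
substF x u ⊥'       = ⊥'
substF x u (t ≐ s)  = substT x u t ≐ substT x u s
substF x u (A ∧' B) = substF x u A ∧' substF x u B
substF x u (A ∨' B) = substF x u A ∨' substF x u B
substF x u (A ⊃ B)  = substF x u A ⊃ substF x u B
substF x u (∀' A)   = ∀' (substF x u A)
substF x u (∃' A)   = ∃' (substF x u A)

openT : ℕ → Term → Term → Term
openT k u (bv i) with k Data.Nat.≟ i
... | Relation.Nullary.yes _ = u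
... | Relation.Nullary.no  _ = bv i
openT k u (fv y)   = fv y
openT k u `0       = `0
openT k u (`S t)   = `S (openT k u t)
openT k u (t `+ s) = openT k u t `+ openT k u s
openT k u (t `* s) = openT k u t `* openT k u s

openF : ℕ → Term → Formula → Formula
openF k u ⊥'       = ⊥'
openF k u (t ≐ s)  = openT k u t ≐ openT k u s
openF k u (A ∧' B) = openF k u A ∧' openF k u B
openF k u (A ∨' B) = openF k u A ∨' openF k u B
openF k u (A ⊃ B)  = openF k u A ⊃ openF k u B
openF k u (∀' A)   = ∀' (openF (suc k) u A)
openF k u (∃' A)   = ∃' (openF (suc k) u A)

inst : Formula → Term → Formula
inst A u = openF 0 u A

data LCt (d : ℕ) : Term → Set where
  bv   : ∀ {i} → i < d → LCt d (bv i)
  fv   : ∀ {x} → LCt d (fv x)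
  `0   : LCt d `0
  `S   : ∀ {t} → LCt d t → LCt d (`S t)
  _`+_ : ∀ {t s} → LCt d t → LCt d s → LCt d (t `+ s)
  _`*_ : ∀ {t s} → LCt d t → LCt d s → LCt d (t `* s)

data LCf (d : ℕ) : Formula → Set where
  ⊥'   : LCf d ⊥'
  _≐_  : ∀ {t s} → LCt d t → LCt d s → LCf d (t ≐ s)
  _∧'_ : ∀ {A B} → LCf d A → LCf d B → LCf d (A ∧' B)
  _∨'_ : ∀ {A B} → LCf d A → LCf d B → LCf d (A ∨' B)
  _⊃_  : ∀ {A B} → LCf d A → LCf d B → LCf d (A ⊃ B)
  ∀'   : ∀ {A} → LCf (suc d) A → LCf d (∀' A)
  ∃'   : ∀ {A} → LCf (suc d) A → LCf d (∃' A)

record Sequent : Set where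
  constructor _⇒_
  field
    ante : List Formula
    succ : Formula
open Sequent public

FVs : Sequent → List ℕ
FVs (Γ ⇒ A) = concatMap FVf Γ ++ FVf A

LCs : Sequent → Set
LCs (Γ ⇒ A) = All (LCf 0) Γ × LCf 0 A

data ArithAx : Formula → Set where
  ax-Sinj  : ∀ s t → ArithAx ((`S s ≐ `S t) ⊃ (s ≐ t))
  ax-S≠0   : ∀ t → ArithAx (¬' (`S t ≐ `0))
  ax-+0    : ∀ t → ArithAx ((t `+ `0) ≐ t)
  ax-+S    : ∀ s t → ArithAx ((s `+ `S t) ≐ `S (s `+ t))
  ax-*0    : ∀ t → ArithAx ((t `* `0) ≐ `0)
  ax-*S    : ∀ s t → ArithAx ((s `* `S t) ≐ ((s `* t) `+ s))

data Inst : Sequent → List Sequent → Set where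
  id   : ∀ A → Inst ((A ∷ []) ⇒ A) []
  ⊥L   : ∀ C → Inst ((⊥' ∷ []) ⇒ C) []
  ∧L   : ∀ Γ A B C → Inst (((A ∧' B) ∷ Γ) ⇒ C) (((A ∷ B ∷ Γ) ⇒ C) ∷ [])
  ∧R   : ∀ Γ A B → Inst (Γ ⇒ (A ∧' B)) ((Γ ⇒ A) ∷ (Γ ⇒ B) ∷ [])
  ∨L   : ∀ Γ A B C → Inst (((A ∨' B) ∷ Γ) ⇒ C) (((A ∷ Γ) ⇒ C) ∷ ((B ∷ Γ) ⇒ C) ∷ [])
  ∨R₁  : ∀ Γ A B → Inst (Γ ⇒ (A ∨' B)) ((Γ ⇒ A) ∷ [])
  ∨R₂  : ∀ Γ A B → Inst (Γ ⇒ (A ∨' B)) ((Γ ⇒ B) ∷ [])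
  ⊃L   : ∀ Γ A B C → Inst (((A ⊃ B) ∷ Γ) ⇒ C) ((Γ ⇒ A) ∷ ((B ∷ Γ) ⇒ C) ∷ [])
  ⊃R   : ∀ Γ A B → Inst (Γ ⇒ (A ⊃ B)) (((A ∷ Γ) ⇒ B) ∷ [])
  ∀L   : ∀ Γ A C t → Inst ((∀' A ∷ Γ) ⇒ C) (((inst A t ∷ Γ) ⇒ C) ∷ [])
  ∀R   : ∀ Γ A y → y ∉ FVs (Γ ⇒ ∀' A) →
         Inst (Γ ⇒ ∀' A) ((Γ ⇒ inst A (fv y)) ∷ [])
  ∃L   : ∀ Γ A C y → y ∉ FVs ((∃' A ∷ Γ) ⇒ C) →
         Inst ((∃' A ∷ Γ) ⇒ C) (((inst A (fv y) ∷ Γ) ⇒ C) ∷ [])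
  ∃R   : ∀ Γ A t → Inst (Γ ⇒ ∃' A) ((Γ ⇒ inst A t) ∷ [])
  =R   : ∀ t → Inst ([] ⇒ (t ≐ t)) []
  =L   : ∀ Γ C x s t →
         Inst (((s ≐ t) ∷ map (substF x t) Γ) ⇒ substF x t C)
              ((map (substF x s) Γ ⇒ substF x s C) ∷ [])
  wk   : ∀ Γ A C → Inst ((A ∷ Γ) ⇒ C) ((Γ ⇒ C) ∷ [])
  ctr  : ∀ Γ A C → Inst ((A ∷ Γ) ⇒ C) ((A ∷ A ∷ Γ) ⇒ C ∷ [])
  ex   : ∀ Γ Δ C → Γ ↭ Δ → Inst (Δ ⇒ C) ((Γ ⇒ C) ∷ [])
  cut  : ∀ Γ A C → Inst (Γ ⇒ C) ((Γ ⇒ A) ∷ ((A ∷ Γ) ⇒ C) ∷ [])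
  ax   : ∀ A → ArithAx A → Inst ([] ⇒ A) []
  case : ∀ x Γ C →
         Inst (Γ ⇒ C)
              ((map (substF x `0) Γ ⇒ substF x `0 C) ∷
               (map (substF x (`S (fv x))) Γ ⇒ substF x (`S (fv x)) C) ∷ [])

IsCase : ∀ {c ps} → ℕ → Inst c ps → Set
IsCase x (case y _ _) = x ≡ y
IsCase x _            = ⊥

RuleInst : Set
RuleInst = Σ Sequent λ c → Σ (List Sequent) λ ps → Inst c ps

conclusion : RuleInst → Sequent
conclusion r = proj₁ r

premises : RuleInst → List Sequent
premises r = proj₁ (proj₂ r)

Node : Set
Node = List ℕ

_≼_ : ∀ {A : Set} → List A → List A → Set
s ≼ t = ∃[ r ] (s ++ r ≡ t)

_≺_ : ∀ {A : Set} → List A → List A → Set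
s ≺ t = ∃[ r ] (¬ (r ≡ []) × s ++ r ≡ t)

_·_ : Node → ℕ → Node
t · i = t ++ [ i ]

record PreProof : Set where
  field
    T          : List Node
    root       : [] ∈ T
    prefClosed : ∀ {s t} → s ≼ t → t ∈ T → s ∈ T
    β          : Node → Maybe Node               -- partial map buds ↦ companions
    λ'         : Node → Sequent
    ρ          : Node → RuleInst                 -- rule instances (relevant on non-buds of T)
    β-bud      : ∀ {t c} → β t ≡ just c → t ∈ T × (∀ i → (t · i) ∉ T)
    β-comp     : ∀ {t c} → β t ≡ just c → ∃[ i ] ((c · i) ∈ T)
    β-below    : ∀ {t c} → β t ≡ just c → c ≺ t
    β-label    : ∀ {t c} → β t ≡ just c → λ' t ≡ λ' c
    ρ-concl    : ∀ {t} → t ∈ T → β t ≡ nothing → conclusion (ρ t) ≡ λ' t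
    ρ-children : ∀ {t} → t ∈ T → β t ≡ nothing →
                 ∀ i → ((t · i) ∈ T → i < length (premises (ρ t)))
                     × (i < length (premises (ρ t)) → (t · i) ∈ T)
    ρ-premises : ∀ {t} → t ∈ T → β t ≡ nothing →
                 ∀ i (p : i < length (premises (ρ t))) →
                 λ' (t · i) ≡ lookup (premises (ρ t)) (fromℕ< p)
    wellformed : ∀ {t} → t ∈ T → LCs (λ' t)

module _ (π : PreProof) where
  open PreProof π

  dom : Node → Set
  dom t = ∃[ c ] (β t ≡ just c)

  im : Node → Set
  im c = ∃[ t ] (β t ≡ just c)

  Injective : Set
  Injective = ∀ {s t c} → β s ≡ just c → β t ≡ just c → s ≡ t

  CaseAt : ℕ → Node → Set
  CaseAt x u = u ∈ T × β u ≡ nothing × IsCase x (proj₂ (proj₂ (ρ u)))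

  Step : Node → Node → Set
  Step u v = (∃[ i ] (v ≡ u · i × v ∈ T)) ⊎ (β u ≡ just v)

  InfBranch : (ℕ → Node) → Set
  InfBranch b = b 0 ≡ [] × (∀ n → Step (b n) (b (suc n)))

  IsCHAProof : Set
  IsCHAProof = ∀ b → InfBranch b →
    ∃[ x ] ((∃[ N ] (∀ n → N ≤ n → x ∈ FVs (λ' (b n))))
            × (∀ m → ∃[ n ] (m ≤ n × CaseAt x (b n))))

  γ : Node → Node → Set
  γ t u = ∃[ c ] (β t ≡ just c × c ≼ u × u ≼ t)

  C[_] : (Node → Set) → Node → Set
  C[ η ] u = ∃[ s ] (η s × γ s u)

  IsPath : List Node → Set
  IsPath p = Linked Step p

  StronglyConnected : (Node → Set) → Set
  StronglyConnected η =
    (∀ {s} → η s → dom s) ×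
    ∃[ v ] ∃[ p ] (IsPath (v ∷ p ++ [ v ])
                   × (∀ w → w ∈ (v ∷ p ++ [ v ]) → C[ η ] w)
                   × (∀ w → C[ η ] w → w ∈ (v ∷ p ++ [ v ])))

  _⊑_ : Node → Node → Set
  s ⊑ t = ∃[ c ] (β s ≡ just c × γ t c)

  _⊑*_ : Node → Node → Set
  _⊑*_ = TransClosure _⊑_

  _<β_ : Node → Node → Set
  s <β t = ∃[ c ] ∃[ d ] (β s ≡ just c × β t ≡ just d × c ≺ d)

  record IsInductionOrder (_⪯_ : Node → Node → Set) (x : Node → ℕ) : Set₁ where
    field
      refl-dom   : ∀ {s} → dom s → s ⪯ s
      trans      : ∀ {s t u} → s ⪯ t → t ⪯ u → s ⪯ u
      on-dom     : ∀ {s t} → s ⪯ t → dom s × dom t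
      x-free     : ∀ {s} → dom s → x s ∈ FVs (λ' s)
      x-cycle    : ∀ {s t} → s ⪯ t → ∀ u → γ s u → x t ∈ FVs (λ' u)
      case-cycle : ∀ {s} → dom s → ∃[ u ] (γ s u × CaseAt (x s) u)
      maximum    : ∀ (η : Node → Set) → StronglyConnected η →
                   ∃[ m ] (η m × (∀ {s} → η s → s ⪯ m))

  S : Node → Node → Set
  S s u = dom u × ∃[ t ] (dom t × γ t s × t ⊑* u)

  Enumerates : (Node → Set) → List Node → Set
  Enumerates P l = (∀ u → u ∈ l → P u) × (∀ u → P u → u ∈ l) × Linked _<β_ l

-- Along ⊑ companions can only move towards the root: if t ⊑* u then β u ≼ β t. Hence every
-- u ∈ S(s) has its companion on the branch from the root to s, these companions are pairwise
-- ≼-comparable, and since β is injective, <β is linear on S(s). For a child t = s · i, the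
-- elements of S(t) other than the bud of t are exactly those reached from a cycle passing
-- through the edge s → t; they lie in S(s), lie <β-below the bud of t, and form a <β-downward
-- closed part of S(s) (a cycle whose companion lies above β u and below s also reaches u).
-- Sorted enumerations of a downward closed subset are prefixes, which gives (2) and (3).
module Submission where

open import Defs
open import Data.Nat using (ℕ)
open import Data.List using (List; []; _∷_; _++_; [_])
open import Data.List.Properties using (++-assoc; ++-identityʳ; ++-identityʳ-unique; ++-conicalˡ; ++-conicalʳ; ∷-injective)
open import Data.List.Membership.Propositional using (_∈_)
open import Data.List.Membership.Propositional.Properties using (∈-++⁺ˡ; ∈-++⁻)
open import Data.List.Relation.Unary.Any using (here; there)
open import Data.List.Relation.Unary.All as All using (All; []; _∷_)
open import Data.List.Relation.Unary.All.Properties using (++⁻ˡ; ++⁻ʳ)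
open import Data.List.Relation.Unary.AllPairs using (AllPairs; []; _∷_)
open import Data.List.Relation.Unary.Linked using (Linked)
open import Data.List.Relation.Unary.Linked.Properties using (Linked⇒AllPairs)
open import Data.Maybe using (just)
open import Data.Maybe.Properties using (just-injective)
open import Data.Product using (Σ; ∃-syntax; _×_; _,_; proj₁; proj₂)
import Data.Product as Product
open import Data.Sum using (_⊎_; inj₁; inj₂; [_,_]′)
import Data.Sum as Sum
open import Data.Empty using (⊥-elim)
open import Function using (_∘_)
open import Relation.Nullary using (¬_)
open import Relation.Binary.Definitions using (Transitive; Irreflexive)
open import Relation.Binary.PropositionalEquality using (_≡_; _≢_; refl; sym; trans; cong; subst)
open import Relation.Binary.Construct.Closure.Transitive using (_∷_) renaming ([_] to [_]⁺)

module Prefix {A : Set} where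

  ≼-refl : ∀ {a : List A} → a ≼ a
  ≼-refl {a} = [] , ++-identityʳ a

  ≼-trans : ∀ {a b c : List A} → a ≼ b → b ≼ c → a ≼ c
  ≼-trans {a} (r , refl) (r′ , refl) = r ++ r′ , sym (++-assoc a r r′)

  ≺⇒≼ : ∀ {a b : List A} → a ≺ b → a ≼ b
  ≺⇒≼ (r , _ , e) = r , e

  ≼⇒≺⊎≡ : ∀ {a b : List A} → a ≼ b → a ≺ b ⊎ a ≡ b
  ≼⇒≺⊎≡ {a} ([] , e) = inj₂ (trans (sym (++-identityʳ a)) e)
  ≼⇒≺⊎≡ (x ∷ r , e) = inj₁ (x ∷ r , (λ ()) , e)

  ≺-irrefl : ∀ {a : List A} → ¬ a ≺ a
  ≺-irrefl {a} (r , r≢[] , e) = r≢[] (++-identityʳ-unique a (sym e))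

  ≼-≺-trans : ∀ {a b c : List A} → a ≼ b → b ≺ c → a ≺ c
  ≼-≺-trans {a} (r , refl) (r′ , r′≢[] , refl) =
    r ++ r′ , r′≢[] ∘ ++-conicalʳ r r′ , sym (++-assoc a r r′)

  ≺-≼-trans : ∀ {a b c : List A} → a ≺ b → b ≼ c → a ≺ c
  ≺-≼-trans {a} (r , r≢[] , refl) (r′ , refl) =
    r ++ r′ , r≢[] ∘ ++-conicalˡ r r′ , sym (++-assoc a r r′)

  ≺-trans : ∀ {a b c : List A} → a ≺ b → b ≺ c → a ≺ c
  ≺-trans a≺b b≺c = ≺-≼-trans a≺b (≺⇒≼ b≺c)

  ∷-≼ : ∀ x {a b : List A} → a ≼ b → (x ∷ a) ≼ (x ∷ b)
  ∷-≼ x (r , e) = r , cong (x ∷_) e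

  ≼-[] : ∀ {a : List A} → a ≼ [] → a ≡ []
  ≼-[] {a} (r , e) = ++-conicalˡ a r e

  ≼-snoc : ∀ (s : List A) x → s ≼ (s ++ [ x ])
  ≼-snoc s x = [ x ] , refl

  ≺-snoc : ∀ (s : List A) x → s ≺ (s ++ [ x ])
  ≺-snoc s x = [ x ] , (λ ()) , refl

  ≼-snoc⁻ : ∀ {a s : List A} {x} → a ≼ (s ++ [ x ]) → a ≡ s ++ [ x ] ⊎ a ≼ s
  ≼-snoc⁻ {[]} {s} _ = inj₂ (s , refl)
  ≼-snoc⁻ {y ∷ a} {[]} (r , e) with ∷-injective e
  ... | refl , a++r≡[] with ≼-[] (r , a++r≡[])
  ...   | refl = inj₁ refl
  ≼-snoc⁻ {y ∷ a} {z ∷ s} (r , e) with ∷-injective e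
  ... | refl , e′ = Sum.map (cong (y ∷_)) (∷-≼ y) (≼-snoc⁻ (r , e′))

  prefixes-comparable : ∀ {a b c : List A} → a ≼ c → b ≼ c → a ≼ b ⊎ b ≼ a
  prefixes-comparable {[]} {b} _ _ = inj₁ (b , refl)
  prefixes-comparable {x ∷ a} {[]} _ _ = inj₂ (x ∷ a , refl)
  prefixes-comparable {x ∷ a} {y ∷ b} (r , refl) (r′ , e) with ∷-injective e
  ... | refl , e′ = Sum.map (∷-≼ x) (∷-≼ x) (prefixes-comparable (r , refl) (r′ , e′))

open Prefix

module StrictlySorted {A : Set} {R : A → A → Set}
                      (R-trans : Transitive R) (R-irrefl : Irreflexive _≡_ R) where

  ∈-tail : ∀ {x z l} → R x z → z ∈ x ∷ l → z ∈ l
  ∈-tail Rxz (here refl) = ⊥-elim (R-irrefl refl Rxz)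
  ∈-tail _ (there z∈l) = z∈l

  AllPairs-snoc⁻ : ∀ l {b} → AllPairs R (l ++ [ b ]) → AllPairs R l × All (λ z → R z b) l
  AllPairs-snoc⁻ [] _ = [] , []
  AllPairs-snoc⁻ (x ∷ l) (x<lb ∷ lb↗) =
    let l↗ , l<b = AllPairs-snoc⁻ l lb↗
    in  ++⁻ˡ l x<lb ∷ l↗ , All.head (++⁻ʳ l x<lb) ∷ l<b

  downClosed-prefix : ∀ {l m} → AllPairs R l → AllPairs R m →
                      (∀ {z} → z ∈ l → z ∈ m) →
                      (∀ {w z} → w ∈ m → z ∈ l → R w z → w ∈ l) → l ≼ m
  downClosed-prefix {[]} {m} _ _ _ _ = m , refl
  downClosed-prefix {x ∷ l} {[]} _ _ l⊆m _ with l⊆m (here refl)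
  ... | ()
  downClosed-prefix {x ∷ l} {y ∷ m} (x<l ∷ l↗) (y<m ∷ m↗) l⊆m closed with l⊆m (here refl)
  ... | there x∈m with closed (here refl) (here refl) (All.lookup y<m x∈m)
  ...   | here refl = ⊥-elim (R-irrefl refl (All.lookup y<m x∈m))
  ...   | there y∈l = ⊥-elim (R-irrefl refl (R-trans (All.lookup x<l y∈l) (All.lookup y<m x∈m)))
  downClosed-prefix {x ∷ l} {y ∷ m} (x<l ∷ l↗) (y<m ∷ m↗) l⊆m closed | here refl =
    ∷-≼ x (downClosed-prefix l↗ m↗
      (λ z∈l → ∈-tail (All.lookup x<l z∈l) (l⊆m (there z∈l)))
      (λ w∈m z∈l Rwz → ∈-tail (All.lookup y<m w∈m) (closed (there w∈m) (there z∈l) Rwz)))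

  sorted-singleton : ∀ {l b} → AllPairs R l → b ∈ l → (∀ {z} → z ∈ l → z ≡ b) → l ≡ [ b ]
  sorted-singleton {x ∷ []} _ _ all≡b = cong [_] (all≡b (here refl))
  sorted-singleton {x ∷ y ∷ l} ((Rxy ∷ _) ∷ _) _ all≡b
    with all≡b (here refl) | all≡b (there (here refl))
  ... | refl | refl = ⊥-elim (R-irrefl refl Rxy)

  sorted-max-last : ∀ {l b} → AllPairs R l → b ∈ l → (∀ {z} → z ∈ l → z ≢ b → R z b) →
                    ∃[ l′ ] (l ≡ l′ ++ [ b ])
  sorted-max-last {x ∷ []} _ (here refl) _ = [] , refl
  sorted-max-last {x ∷ y ∷ l} ((Rxy ∷ _) ∷ _) (here refl) below =
    ⊥-elim (R-irrefl refl (R-trans Rxy (below (there (here refl)) (λ y≡x → R-irrefl (sym y≡x) Rxy))))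
  sorted-max-last {x ∷ l} (_ ∷ l↗) (there b∈l) below =
    Product.map (x ∷_) (cong (x ∷_)) (sorted-max-last l↗ b∈l (below ∘ there))

  sorted-init-prefix : ∀ {l m b} → AllPairs R (l ++ [ b ]) → AllPairs R m →
                       (∀ {z} → z ∈ l ++ [ b ] → R z b → z ∈ m) →
                       (∀ {w z} → w ∈ m → z ∈ l ++ [ b ] → R z b → R w z → w ∈ l ++ [ b ]) →
                       l ≼ m
  sorted-init-prefix {l} {m} {b} lb↗ m↗ below⊆m closed =
    downClosed-prefix (proj₁ l↗×l<b) m↗ (λ z∈l → below⊆m (∈-++⁺ˡ z∈l) (below-b z∈l)) closed′
    where
    l↗×l<b : AllPairs R l × All (λ z → R z b) l
    l↗×l<b = AllPairs-snoc⁻ l lb↗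
    below-b : ∀ {z} → z ∈ l → R z b
    below-b = All.lookup (proj₂ l↗×l<b)
    closed′ : ∀ {w z} → w ∈ m → z ∈ l → R w z → w ∈ l
    closed′ w∈m z∈l Rwz with ∈-++⁻ l (closed w∈m (∈-++⁺ˡ z∈l) (below-b z∈l) Rwz)
    ... | inj₁ w∈l = w∈l
    ... | inj₂ (here refl) = ⊥-elim (R-irrefl refl (R-trans Rwz (below-b z∈l)))

  sorted-max-split : ∀ {l m b} → AllPairs R l → AllPairs R m → b ∈ l →
                     (∀ {z} → z ∈ l → z ≢ b → R z b) →
                     (∀ {z} → z ∈ l → R z b → z ∈ m) →
                     (∀ {w z} → w ∈ m → z ∈ l → R z b → R w z → w ∈ l) →
                     ∃[ l′ ] (l′ ≼ m × l ≡ l′ ++ [ b ])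
  sorted-max-split l↗ m↗ b∈l below below⊆m closed with sorted-max-last l↗ b∈l below
  ... | l′ , refl = l′ , sorted-init-prefix l↗ m↗ below⊆m closed , refl

module Cycles (π : PreProof) where
  open PreProof π

  infix 4 _⊑⁺_ _<ᵦ_
  _⊑⁺_ _<ᵦ_ : Node → Node → Set
  _⊑⁺_ = _⊑*_ π
  _<ᵦ_ = _<β_ π

  companion-unique : ∀ {t c d} → β t ≡ just c → β t ≡ just d → c ≡ d
  companion-unique p q = just-injective (trans (sym p) q)

  companion-≼ : ∀ {t c} → β t ≡ just c → c ≼ t
  companion-≼ e = ≺⇒≼ (β-below e)

  γ-companion : ∀ {t c} → β t ≡ just c → γ π t c
  γ-companion e = _ , e , ≼-refl , companion-≼ e

  γ-convex : ∀ {v c c′ cv} → β v ≡ just cv → cv ≼ c′ → c′ ≼ c → γ π v c → γ π v c′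
  γ-convex ev cv≼c′ c′≼c (_ , ev′ , _ , c≼v) =
    _ , ev′ , subst (_≼ _) (companion-unique ev ev′) cv≼c′ , ≼-trans c′≼c c≼v

  ⊑-refl : ∀ {t c} → β t ≡ just c → _⊑_ π t t
  ⊑-refl e = _ , e , γ-companion e

  ⊑⇒γ : ∀ {t u c} → _⊑_ π t u → β t ≡ just c → γ π u c
  ⊑⇒γ {u = u} (_ , e′ , γu) e = subst (γ π u) (companion-unique e′ e) γu

  ⊑⁺-dom : ∀ {t u} → t ⊑⁺ u → dom π u
  ⊑⁺-dom [ _ , _ , cu , eu , _ ]⁺ = cu , eu
  ⊑⁺-dom (_ ∷ w⊑⁺u) = ⊑⁺-dom w⊑⁺u

  ⊑⁺-companion-≼ : ∀ {t u ct cu} → t ⊑⁺ u → β t ≡ just ct → β u ≡ just cu → cu ≼ ct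
  ⊑⁺-companion-≼ [ t⊑u ]⁺ et eu with ⊑⇒γ t⊑u et
  ... | _ , eu′ , cu≼ct , _ = subst (_≼ _) (companion-unique eu′ eu) cu≼ct
  ⊑⁺-companion-≼ (t⊑w ∷ w⊑⁺u) et eu with ⊑⇒γ t⊑w et
  ... | _ , ew , cw≼ct , _ = ≼-trans (⊑⁺-companion-≼ w⊑⁺u ew eu) cw≼ct

  ⊑⁺-reroot : ∀ {t u v cu cv} → t ⊑⁺ v → β u ≡ just cu → cu ≼ t →
              β v ≡ just cv → cv ≼ cu → u ⊑⁺ v
  ⊑⁺-reroot t⊑⁺v@([ ct , et , γv ]⁺) eu cu≼t ev cv≼cu
    with prefixes-comparable (companion-≼ et) cu≼t
  ... | inj₁ ct≼cu = (_ , eu , _ , et , ct≼cu , cu≼t) ∷ t⊑⁺v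
  ... | inj₂ cu≼ct = [ _ , eu , γ-convex ev cv≼cu cu≼ct γv ]⁺
  ⊑⁺-reroot t⊑⁺v@((ct , et , _ , _ , _ , ct≼w) ∷ w⊑⁺v) eu cu≼t ev cv≼cu
    with prefixes-comparable (companion-≼ et) cu≼t
  ... | inj₁ ct≼cu = (_ , eu , _ , et , ct≼cu , cu≼t) ∷ t⊑⁺v
  ... | inj₂ cu≼ct = ⊑⁺-reroot w⊑⁺v eu (≼-trans cu≼ct ct≼w) ev cv≼cu

  bud∈S-companion : ∀ {b c} → β b ≡ just c → S π c b
  bud∈S-companion e = (_ , e) , _ , (_ , e) , γ-companion e , [ ⊑-refl e ]⁺

  S-companion-≼ : ∀ {s u} → S π s u → ∃[ cu ] (β u ≡ just cu × cu ≼ s)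
  S-companion-≼ ((cu , eu) , _ , _ , (_ , et , ct≼s , _) , t⊑⁺u) =
    cu , eu , ≼-trans (⊑⁺-companion-≼ t⊑⁺u et eu) ct≼s

  S-root-companion : ∀ {u} → S π [] u → β u ≡ just []
  S-root-companion Su with S-companion-≼ Su
  ... | _ , eu , cu≼[] with ≼-[] cu≼[]
  ...   | refl = eu

  S-reached-from : ∀ {s t u ct cu} → S π s u → β t ≡ just ct → ct ≼ s →
                   β u ≡ just cu → cu ≼ ct → t ⊑⁺ u
  S-reached-from (_ , _ , _ , (_ , _ , _ , s≼t′) , t′⊑⁺u) et ct≼s eu cu≼ct =
    ⊑⁺-reroot t′⊑⁺u et (≼-trans ct≼s s≼t′) eu cu≼ct

  <ᵦ-trans : Transitive _<ᵦ_
  <ᵦ-trans (_ , _ , ec , ed , c≺d) (_ , e , ed′ , ee , d≺e) =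
    _ , e , ec , ee , ≺-trans c≺d (subst (_≺ e) (companion-unique ed′ ed) d≺e)

  <ᵦ-irrefl : Irreflexive _≡_ _<ᵦ_
  <ᵦ-irrefl refl (_ , _ , ec , ed , c≺d) = ≺-irrefl (subst (_ ≺_) (companion-unique ed ec) c≺d)

  open StrictlySorted <ᵦ-trans <ᵦ-irrefl

  sorted : ∀ {l} → Linked _<ᵦ_ l → AllPairs _<ᵦ_ l
  sorted = Linked⇒AllPairs <ᵦ-trans

  companion-≼⇒<ᵦ⊎≡ : Injective π → ∀ {u v cu cv} → β u ≡ just cu → β v ≡ just cv →
                     cu ≼ cv → u <ᵦ v ⊎ u ≡ v
  companion-≼⇒<ᵦ⊎≡ inj eu ev cu≼cv with ≼⇒≺⊎≡ cu≼cv
  ... | inj₁ cu≺cv = inj₁ (_ , _ , eu , ev , cu≺cv)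
  ... | inj₂ refl = inj₂ (inj eu ev)

  S-linear : Injective π → ∀ {s u v} → S π s u → S π s v → u <ᵦ v ⊎ u ≡ v ⊎ v <ᵦ u
  S-linear inj Su Sv with S-companion-≼ Su | S-companion-≼ Sv
  ... | _ , eu , cu≼s | _ , ev , cv≼s with prefixes-comparable cu≼s cv≼s
  ...   | inj₁ cu≼cv = Sum.map₂ inj₁ (companion-≼⇒<ᵦ⊎≡ inj eu ev cu≼cv)
  ...   | inj₂ cv≼cu = [ inj₂ ∘ inj₂ , inj₂ ∘ inj₁ ∘ sym ]′ (companion-≼⇒<ᵦ⊎≡ inj ev eu cv≼cu)

  CycleThrough : Node → ℕ → Node → Set
  CycleThrough s i t = ∃[ c ] (β t ≡ just c × c ≼ s × (s · i) ≼ t)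

  ReachedThrough : Node → ℕ → Node → Set
  ReachedThrough s i u = ∃[ t ] (CycleThrough s i t × t ⊑⁺ u)

  ReachedThrough⇒S-parent : ∀ {s i u} → ReachedThrough s i u → S π s u
  ReachedThrough⇒S-parent {s} {i} (t , (c , e , c≼s , s·i≼t) , t⊑⁺u) =
    ⊑⁺-dom t⊑⁺u , t , (c , e) , (c , e , c≼s , ≼-trans (≼-snoc s i) s·i≼t) , t⊑⁺u

  ReachedThrough⇒S-child : ∀ {s i u} → ReachedThrough s i u → S π (s · i) u
  ReachedThrough⇒S-child {s} {i} (t , (c , e , c≼s , s·i≼t) , t⊑⁺u) =
    ⊑⁺-dom t⊑⁺u , t , (c , e) , (c , e , ≼-trans c≼s (≼-snoc s i) , s·i≼t) , t⊑⁺u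

  reached-through-self : ∀ {s i u} → γ π u (s · i) → β u ≢ just (s · i) → ReachedThrough s i u
  reached-through-self (c , e , c≼s·i , s·i≼u) u≢ with ≼-snoc⁻ c≼s·i
  ... | inj₁ refl = ⊥-elim (u≢ e)
  ... | inj₂ c≼s = _ , (c , e , c≼s , s·i≼u) , [ ⊑-refl e ]⁺

  -- A ⊑-chain starting from a cycle through s · i can only leave the cycle of the companion
  -- s · i itself through a cycle that also contains s.
  reached-through : ∀ {s i t u} → γ π t (s · i) → t ⊑⁺ u → β u ≢ just (s · i) →
                    ReachedThrough s i u
  reached-through (c , e , c≼s·i , s·i≼t) t⊑⁺u u≢ with ≼-snoc⁻ c≼s·i
  ... | inj₂ c≼s = _ , (c , e , c≼s , s·i≼t) , t⊑⁺u
  reached-through (_ , e , _) [ t⊑u ]⁺ u≢ | inj₁ refl =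
    reached-through-self (⊑⇒γ t⊑u e) u≢
  reached-through (_ , e , _) (t⊑w ∷ w⊑⁺u) u≢ | inj₁ refl =
    reached-through (⊑⇒γ t⊑w e) w⊑⁺u u≢

  S-child⇒ReachedThrough : ∀ {s i u} → S π (s · i) u → β u ≢ just (s · i) → ReachedThrough s i u
  S-child⇒ReachedThrough (_ , _ , _ , γt , t⊑⁺u) = reached-through γt t⊑⁺u

  ReachedThrough-downClosed : ∀ {s i w z} → ReachedThrough s i z → S π s w → w <ᵦ z →
                              ReachedThrough s i w
  ReachedThrough-downClosed (t , cyc@(_ , et , ct≼s , _) , t⊑⁺z) Sw (_ , _ , ew , ez , cw≺cz) =
    t , cyc , S-reached-from Sw et ct≼s ew (≼-trans (≺⇒≼ cw≺cz) (⊑⁺-companion-≼ t⊑⁺z et ez))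

  ReachedThrough-<ᵦ-bud : ∀ {s i b z} → β b ≡ just (s · i) → ReachedThrough s i z → z <ᵦ b
  ReachedThrough-<ᵦ-bud {s} {i} eb Rz with S-companion-≼ (ReachedThrough⇒S-parent Rz)
  ... | _ , ez , cz≼s = _ , _ , ez , eb , ≼-≺-trans cz≼s (≺-snoc s i)

  enum-root-empty : ∀ {l} → ¬ im π [] → Enumerates π (S π []) l → l ≡ []
  enum-root-empty {[]} _ _ = refl
  enum-root-empty {u ∷ _} no-bud (l⊆S , _) = ⊥-elim (no-bud (u , S-root-companion (l⊆S u (here refl))))

  enum-root-bud : Injective π → ∀ {b l} → β b ≡ just [] → Enumerates π (S π []) l → l ≡ [ b ]
  enum-root-bud inj {b} eb (l⊆S , S⊆l , l↗) =
    sorted-singleton (sorted l↗) (S⊆l b (bud∈S-companion eb))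
      (λ z∈l → inj (S-root-companion (l⊆S _ z∈l)) eb)

  enum-child-prefix : ∀ {s i ls lt} → ¬ im π (s · i) →
                      Enumerates π (S π s) ls → Enumerates π (S π (s · i)) lt → lt ≼ ls
  enum-child-prefix {s} {i} {ls} {lt} no-bud (ls⊆S , S⊆ls , ls↗) (lt⊆S , S⊆lt , lt↗) =
    downClosed-prefix (sorted lt↗) (sorted ls↗)
      (λ z∈lt → S⊆ls _ (ReachedThrough⇒S-parent (reached z∈lt)))
      (λ w∈ls z∈lt w<z →
         S⊆lt _ (ReachedThrough⇒S-child (ReachedThrough-downClosed (reached z∈lt) (ls⊆S _ w∈ls) w<z)))
    where
    reached : ∀ {z} → z ∈ lt → ReachedThrough s i z
    reached z∈lt = S-child⇒ReachedThrough (lt⊆S _ z∈lt) (λ e → no-bud (_ , e))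

  enum-child-bud : Injective π → ∀ {s i b ls lt} → β b ≡ just (s · i) →
                   Enumerates π (S π s) ls → Enumerates π (S π (s · i)) lt →
                   ∃[ l ] (l ≼ ls × lt ≡ l ++ [ b ])
  enum-child-bud inj {s} {i} {b} {ls} {lt} eb (ls⊆S , S⊆ls , ls↗) (lt⊆S , S⊆lt , lt↗) =
    sorted-max-split (sorted lt↗) (sorted ls↗) (S⊆lt b (bud∈S-companion eb))
      (λ z∈lt z≢b → ReachedThrough-<ᵦ-bud eb (reached z∈lt z≢b))
      (λ z∈lt z<b → S⊆ls _ (ReachedThrough⇒S-parent (reached z∈lt (<⇒≢ z<b))))
      (λ w∈ls z∈lt z<b w<z →
         S⊆lt _ (ReachedThrough⇒S-child
           (ReachedThrough-downClosed (reached z∈lt (<⇒≢ z<b)) (ls⊆S _ w∈ls) w<z)))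
    where
    <⇒≢ : ∀ {z} → z <ᵦ b → z ≢ b
    <⇒≢ z<b z≡b = <ᵦ-irrefl z≡b z<b
    reached : ∀ {z} → z ∈ lt → z ≢ b → ReachedThrough s i z
    reached z∈lt z≢b = S-child⇒ReachedThrough (lt⊆S _ z∈lt) (λ e → z≢b (inj e eb))

lemma5p9 : (π : PreProof) → IsCHAProof π → Injective π →
    (Σ (Node → ℕ) λ x → IsInductionOrder π (_⊑*_ π) x) →
    (∀ s → s ∈ PreProof.T π → ∀ u v → S π s u → S π s v →
       _<β_ π u v ⊎ u ≡ v ⊎ _<β_ π v u)
    ×
    (∀ (σ : Node → List Node) →
       (∀ s → s ∈ PreProof.T π → Enumerates π (S π s) (σ s)) →
       ((¬ im π [] → σ [] ≡ []) ×
        (∀ b → PreProof.β π b ≡ just [] → σ [] ≡ b ∷ []))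
       ×
       (∀ s i → (s · i) ∈ PreProof.T π → ¬ im π (s · i) → σ (s · i) ≼ σ s)
       ×
       (∀ s i b → (s · i) ∈ PreProof.T π → PreProof.β π b ≡ just (s · i) →
          ∃[ u ] (u ≼ σ s × σ (s · i) ≡ u ++ [ b ])))
lemma5p9 π _ inj _ =
  (λ _ _ _ _ → S-linear inj) ,
  λ σ enum →
    ( (λ no-bud → enum-root-empty no-bud (enum [] root))
    , (λ b eb → enum-root-bud inj eb (enum [] root)) )
    , (λ s i s·i∈T no-bud → enum-child-prefix no-bud (enum s (parent∈T s·i∈T)) (enum (s · i) s·i∈T))
    , (λ s i b s·i∈T eb → enum-child-bud inj eb (enum s (parent∈T s·i∈T)) (enum (s · i) s·i∈T))
  where
  open PreProof π
  open Cycles π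

  parent∈T : ∀ {s i} → (s · i) ∈ T → s ∈ T
  parent∈T {s} {i} = prefClosed (≼-snoc s i)
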